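{- Let $n,m\ge 5$ be integers. Then $\mu_{\rm t}(K_n\times K_m)=\mu_{\rm o}(K_n\times K_m)=\mu_{\rm d}(K_n\times K_m)=\mu(K_n\times K_m)$.
   Context: $K_n\times K_m$ is the direct product of complete graphs: vertex set $[n]\times[m]$, with $(i,j)$ adjacent to $(i',j')$ iff $i\ne i'$ and $j\ne j'$. For a connected graph $G$ and $X\subseteq V(G)$, two vertices $x,y$ are $X$-visible if there is a shortest $x,y$-path whose internal vertices are not in $X$. $X$ is: a mutual-visibility set if any two vertices of $X$ are $X$-visible; an outer mutual-visibility set if moreover any $x\in X$ and $y\notin X$ are $X$-visible; a dual mutual-visibility set if any two vertices of $X$ and any two vertices of $V(G)\setminus X$ are $X$-visible; a total mutual-visibility set if any two vertices of $V(G)$ are $X$-visible. $\mu,\mu_{\rm o},\mu_{\rm d},\mu_{\rm t}$ denote the maximum cardinalities of such sets, respectively. -}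

module Defs where

open import Data.Nat using (ℕ; zero; suc; _≤_; _<_)
open import Data.Fin using (Fin)
open import Data.Product using (_×_; _,_; Σ; ∃)
open import Data.List using (List; length)
open import Data.List.Membership.Propositional using (_∈_)
open import Data.List.Relation.Unary.Unique.Propositional using (Unique)
open import Relation.Nullary using (¬_)
open import Relation.Binary.PropositionalEquality using (_≡_; _≢_)

module Graph {V : Set} (Adj : V → V → Set) where

  data Walk (Ok : V → Set) : V → V → ℕ → Set where
    here : ∀ {x} → Walk Ok x x zero
    edge : ∀ {x y} → Adj x y → Walk Ok x y (suc zero)
    step : ∀ {x z y k} → Adj x z → Ok z → Walk Ok z y (suc k) → Walk Ok x y (suc (suc k))

  Anything : V → Set
  Anything _ = Data.Unit.⊤
    where import Data.Unit

  IsDist : V → V → ℕ → Set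
  IsDist x y k = Walk Anything x y k × (∀ j → j < k → ¬ Walk Anything x y j)

  Visible : List V → V → V → Set
  Visible X x y = Σ ℕ λ k → IsDist x y k × Walk (λ z → ¬ (z ∈ X)) x y k

  -- vertex sets are duplicate-free lists; cardinality = length
  IsMutualVis : List V → Set
  IsMutualVis X = ∀ x y → x ∈ X → y ∈ X → Visible X x y

  IsOuterMutualVis : List V → Set
  IsOuterMutualVis X = IsMutualVis X × (∀ x y → x ∈ X → ¬ (y ∈ X) → Visible X x y)

  IsDualMutualVis : List V → Set
  IsDualMutualVis X = IsMutualVis X × (∀ x y → ¬ (x ∈ X) → ¬ (y ∈ X) → Visible X x y)

  IsTotalMutualVis : List V → Set
  IsTotalMutualVis X = ∀ x y → Visible X x y

  IsMaxCard : (List V → Set) → ℕ → Set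
  IsMaxCard P k = (Σ (List V) λ X → Unique X × P X × length X ≡ k)
                × (∀ X → Unique X → P X → length X ≤ k)

KK-Adj : (n m : ℕ) → Fin n × Fin m → Fin n × Fin m → Set
KK-Adj n m (i , j) (i' , j') = (i ≢ i') × (j ≢ j')

module KK (n m : ℕ) = Graph (KK-Adj n m)

-- Two distinct non-adjacent vertices of K_n × K_m share a row or a column and are at
-- distance two. Deleting four diagonal vertices leaves a total mutual-visibility set: for
-- any such pair, one of the four diagonal vertices avoids the three row/column indices
-- involved and is a common neighbour outside the set. Conversely, a mutual-visibility set
-- misses at least four vertices: if it missed at most three, there would be two of its
-- vertices in a common row (or column) all of whose common neighbours belong to it. Take a
-- row free of missing vertices if these occupy at most two columns, dually for rows, and
-- otherwise the row of one missing vertex together with the columns of the other two.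
-- The argument only needs n, m ≥ 4.

module Submission where

open import Defs
open import Data.Nat using (ℕ; zero; suc; _≤_; _<_; _+_; z≤n; s≤s; _≤?_)
open import Data.Nat.Properties
  using (<-cmp; ≰⇒>; <⇒≱; <⇒≤; ≤-refl; +-suc; +-cancelʳ-≤; +-monoˡ-≤; +-monoʳ-≤; +-comm; module ≤-Reasoning)
  renaming (_≟_ to _≟ℕ_)
open import Data.Product using (_×_; Σ; ∃; ∃₂; _,_; proj₁; proj₂)
open import Data.Product.Properties using (≡-dec)
open import Data.Sum using (_⊎_; inj₁; inj₂; [_,_])
open import Data.Fin using (Fin; toℕ; inject≤; fromℕ<)
import Data.Fin.Properties as Fin
open import Data.List using (List; []; _∷_; length; filter; map; cartesianProduct; allFin)
open import Data.List.Properties using (length-removeAt′; length-map; length-tabulate)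
open import Data.List.Membership.Propositional using (_∈_; _∉_; find; lose)
open import Data.List.Membership.Propositional.Properties
  using (∈-filter⁺; ∈-filter⁻; ∈-map⁺; ∈-map⁻; ∈-cartesianProduct⁺; ∈-allFin; ∈-++⁺ˡ)
open import Data.List.Relation.Binary.Subset.Propositional using (_⊆_)
open import Data.List.Relation.Unary.Any using (here; there; _─_; any?)
open import Data.List.Relation.Unary.All as All using (All; []; _∷_)
open import Data.List.Relation.Unary.All.Properties using (¬Any⇒All¬; All¬⇒¬Any)
open import Data.List.Relation.Unary.AllPairs using (_∷_)
open import Data.List.Relation.Unary.Unique.Propositional using (Unique)
import Data.List.Relation.Unary.Unique.Propositional.Properties as Unique
open import Data.Unit using (tt)
open import Function using (id; _∘_)
open import Relation.Nullary using (¬_; Dec; yes; no; ¬?; contradiction)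
open import Relation.Nullary.Decidable using (decidable-stable; _×-dec_)
open import Relation.Unary using (Decidable)
open import Relation.Unary.Properties using (∁?)
open import Relation.Binary.Definitions using (DecidableEquality; tri<; tri≈; tri>)
open import Relation.Binary.PropositionalEquality using (_≡_; _≢_; refl; sym; trans; cong; subst; ≢-sym)

module _ {A : Set} where

  ∈-─ : ∀ {x z} {ys : List A} (p : x ∈ ys) → z ∈ ys → z ≢ x → z ∈ (ys ─ p)
  ∈-─ (here refl) (here refl) z≢x = contradiction refl z≢x
  ∈-─ (here _)    (there q)   _   = q
  ∈-─ (there _)   (here q)    _   = here q
  ∈-─ (there p)   (there q)   z≢x = there (∈-─ p q z≢x)

  Unique-⊆⇒length≤ : ∀ {xs ys : List A} → Unique xs → xs ⊆ ys → length xs ≤ length ys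
  Unique-⊆⇒length≤ {[]}     _             _     = z≤n
  Unique-⊆⇒length≤ {x ∷ xs} {ys} (x≢xs ∷ u) xs⊆ys =
    subst (suc (length xs) ≤_) (sym (length-removeAt′ ys _))
      (s≤s (Unique-⊆⇒length≤ u λ z∈xs →
        ∈-─ x∈ys (xs⊆ys (there z∈xs)) (≢-sym (All.lookup x≢xs z∈xs))))
    where x∈ys = xs⊆ys (here refl)

  length-filter+length-filter-∁ : ∀ {P : A → Set} (P? : Decidable P) xs →
    length (filter P? xs) + length (filter (∁? P?) xs) ≡ length xs
  length-filter+length-filter-∁ P? [] = refl
  length-filter+length-filter-∁ P? (x ∷ xs) with P? x
  ... | yes _ = cong suc (length-filter+length-filter-∁ P? xs)
  ... | no _  = trans (+-suc _ _) (cong suc (length-filter+length-filter-∁ P? xs))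

  ⊆-triple : A → (ys : List A) → length ys ≤ 3 → ∃ λ ((a , b , c) : A × A × A) → ys ⊆ a ∷ b ∷ c ∷ []
  ⊆-triple d []                _ = (d , d , d) , λ ()
  ⊆-triple d (a ∷ [])          _ = (a , d , d) , ∈-++⁺ˡ
  ⊆-triple d (a ∷ b ∷ [])      _ = (a , b , d) , ∈-++⁺ˡ
  ⊆-triple d (a ∷ b ∷ c ∷ [])  _ = (a , b , c) , id
  ⊆-triple d (_ ∷ _ ∷ _ ∷ _ ∷ _) (s≤s (s≤s (s≤s ())))

  module _ (_≟_ : DecidableEquality A) where
    open import Data.List.Membership.DecPropositional _≟_ using (_∈?_)

    ∃-All≢ : ∀ {cs} (L : List A) → Unique cs → length L < length cs → ∃ λ z → z ∈ cs × All (z ≢_) L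
    ∃-All≢ {cs} L u L<cs with any? (λ z → ¬? (z ∈? L)) cs
    ... | yes p = let z , z∈cs , z∉L = find p in z , z∈cs , ¬Any⇒All¬ L z∉L
    ... | no ¬p = contradiction (Unique-⊆⇒length≤ u cs⊆L) (<⇒≱ L<cs)
      where
        cs⊆L : cs ⊆ L
        cs⊆L {z} z∈cs = decidable-stable (z ∈? L) (¬p ∘ lose z∈cs)

    distinct⊎twoValued : (a b c : A) →
      (a ≢ b × a ≢ c × b ≢ c) ⊎ ∃₂ λ u v → a ∷ b ∷ c ∷ [] ⊆ u ∷ v ∷ []
    distinct⊎twoValued a b c with a ≟ b | a ≟ c | b ≟ c
    ... | yes refl | _ | _ = inj₂ (a , c , λ where
      (here e)                 → here e
      (there (here e))         → here e
      (there (there (here e))) → there (here e))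
    ... | no _ | yes refl | _ = inj₂ (a , b , λ where
      (here e)                 → here e
      (there (here e))         → there (here e)
      (there (there (here e))) → here e)
    ... | no _ | no _ | yes refl = inj₂ (a , b , λ where
      (here e)                 → here e
      (there (here e))         → there (here e)
      (there (there (here e))) → there (here e))
    ... | no a≢b | no a≢c | no b≢c = inj₁ (a≢b , a≢c , b≢c)

∃-All≢-Fin : ∀ {k} (L : List (Fin k)) → length L < k → ∃ λ i → All (i ≢_) L
∃-All≢-Fin {k} L L<k =
  let i , _ , i≢L = ∃-All≢ Fin._≟_ L (Unique.allFin⁺ k) (subst (length L <_) (sym (length-tabulate id)) L<k)
  in i , i≢L

∃-All-toℕ≢ : ∀ {k} (L : List ℕ) → length L < k → ∃ λ (i : Fin k) → All (toℕ i ≢_) L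
∃-All-toℕ≢ {k} L L<k =
  let t , t∈ , t≢L = ∃-All≢ _≟ℕ_ L (Unique.map⁺ Fin.toℕ-injective (Unique.allFin⁺ k)) L<|toℕs|
      i , _ , t≡i = ∈-map⁻ toℕ t∈
  in i , subst (λ s → All (s ≢_) L) t≡i t≢L
  where
    L<|toℕs| : length L < length (map toℕ (allFin k))
    L<|toℕs| = subst (length L <_) (sym (trans (length-map toℕ (allFin k)) (length-tabulate id))) L<k

toℕ≢⇒≢inject≤ : ∀ {k l} {a : Fin k} {i : Fin l} .(k≤l : k ≤ l) → toℕ a ≢ toℕ i → i ≢ inject≤ a k≤l
toℕ≢⇒≢inject≤ {a = a} k≤l a≢i refl = a≢i (sym (Fin.toℕ-inject≤ a k≤l))

distinct-pair-⊇ : ∀ {k} → 1 < k → (u v : Fin k) → ∃₂ λ j j' → j ≢ j' × u ∷ v ∷ [] ⊆ j ∷ j' ∷ []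
distinct-pair-⊇ 1<k u v with u Fin.≟ v
... | no u≢v = u , v , u≢v , id
... | yes refl with ∃-All≢-Fin (u ∷ []) 1<k
...   | w , w≢u ∷ [] = u , w , ≢-sym w≢u , λ { (here e) → here e ; (there (here e)) → here e }

module GraphProperties {V : Set} (Adj : V → V → Set) where
  open Graph Adj

  isDist-unique : ∀ {x y k l} → IsDist x y k → IsDist x y l → k ≡ l
  isDist-unique {k = k} {l} (w , shortest) (w' , shortest') with <-cmp k l
  ... | tri< k<l _ _ = contradiction w (shortest' k k<l)
  ... | tri≈ _ k≡l _ = k≡l
  ... | tri> _ _ l<k = contradiction w' (shortest l l<k)

  isDist-one : ∀ {x y} → x ≢ y → Adj x y → IsDist x y 1
  isDist-one {x} {y} x≢y xy = edge xy , shorter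
    where
      shorter : ∀ k → k < 1 → ¬ Walk Anything x y k
      shorter zero    _        here = x≢y refl
      shorter (suc _) (s≤s ()) _

  isDist-two : ∀ {x y z} → x ≢ y → ¬ Adj x y → Adj x z → Adj z y → IsDist x y 2
  isDist-two {x} {y} x≢y ¬xy xz zy = step xz tt (edge zy) , shorter
    where
      shorter : ∀ k → k < 2 → ¬ Walk Anything x y k
      shorter zero          _ here      = x≢y refl
      shorter (suc zero)    _ (edge xy) = ¬xy xy
      shorter (suc (suc _)) (s≤s (s≤s ())) _

  midpoint : ∀ {Ok x y} → Walk Ok x y 2 → ∃ λ z → Adj x z × Ok z × Adj z y
  midpoint (step xz ok (edge zy)) = _ , xz , ok , zy

  ¬visible-if-neighbours-in : ∀ {X x y} → IsDist x y 2 → (∀ {z} → Adj x z → Adj z y → z ∈ X) →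
    ¬ Visible X x y
  ¬visible-if-neighbours-in d closed (k , d' , w) with refl ← isDist-unique d d' =
    let _ , xz , z∉X , zy = midpoint w in z∉X (closed xz zy)

  totalMutualVis-if-windows : ∀ {X} → DecidableEquality V → (∀ x y → Dec (Adj x y)) →
    (∀ {x y} → x ≢ y → ¬ Adj x y → ∃ λ z → Adj x z × Adj z y × z ∉ X) → IsTotalMutualVis X
  totalMutualVis-if-windows _≟_ adjacent? window x y with x ≟ y | adjacent? x y
  ... | yes refl | _        = 0 , (here , λ _ ()) , here
  ... | no x≢y   | yes xy   = 1 , isDist-one x≢y xy , edge xy
  ... | no x≢y   | no ¬xy   =
    let z , xz , zy , z∉X = window x≢y ¬xy in 2 , isDist-two x≢y ¬xy xz zy , step xz z∉X (edge zy)

  maxCards-coincide : ∀ {X₀} → Unique X₀ → IsTotalMutualVis X₀ →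
    (∀ X → Unique X → IsMutualVis X → length X ≤ length X₀) →
    IsMaxCard IsTotalMutualVis (length X₀) × IsMaxCard IsOuterMutualVis (length X₀)
      × IsMaxCard IsDualMutualVis (length X₀) × IsMaxCard IsMutualVis (length X₀)
  maxCards-coincide {X₀} u total bound =
    ((X₀ , u , total , refl) , λ X u' t → bound X u' (total⇒mutual t))
    , ((X₀ , u , (total⇒mutual total , λ x y _ _ → total x y) , refl) , λ X u' o → bound X u' (proj₁ o))
    , ((X₀ , u , (total⇒mutual total , λ x y _ _ → total x y) , refl) , λ X u' d → bound X u' (proj₁ d))
    , ((X₀ , u , total⇒mutual total , refl) , bound)
    where
      total⇒mutual : ∀ {X} → IsTotalMutualVis X → IsMutualVis X
      total⇒mutual t x y _ _ = t x y

  record HiddenPair (C : List V) : Set where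
    field
      x y                 : V
      x∉C                 : x ∉ C
      y∉C                 : y ∉ C
      distance-two        : IsDist x y 2
      no-common-neighbour : ∀ {z} → Adj x z → Adj z y → z ∉ C

  HiddenPair-⊆ : ∀ {C D} → D ⊆ C → HiddenPair C → HiddenPair D
  HiddenPair-⊆ D⊆C h = record
    { x = x ; y = y ; x∉C = x∉C ∘ D⊆C ; y∉C = y∉C ∘ D⊆C ; distance-two = distance-two
    ; no-common-neighbour = λ xz zy → no-common-neighbour xz zy ∘ D⊆C }
    where open HiddenPair h

  hiddenPair⇒¬mutualVis : DecidableEquality V → ∀ {X C} → (∀ {v} → v ∉ X → v ∈ C) →
    HiddenPair C → ¬ IsMutualVis X
  hiddenPair⇒¬mutualVis _≟_ {X} {C} outside⊆C h mv =
    ¬visible-if-neighbours-in distance-two (λ xz zy → inX (no-common-neighbour xz zy))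
      (mv x y (inX x∉C) (inX y∉C))
    where
      open HiddenPair h
      open import Data.List.Membership.DecPropositional _≟_ using (_∈?_)
      inX : ∀ {v} → v ∉ C → v ∈ X
      inX {v} v∉C = decidable-stable (v ∈? X) (v∉C ∘ outside⊆C)

module DirectProduct (n m : ℕ) where
  open KK n m
  open GraphProperties (KK-Adj n m)

  V : Set
  V = Fin n × Fin m

  _≟_ : DecidableEquality V
  _≟_ = ≡-dec Fin._≟_ Fin._≟_

  open import Data.List.Membership.DecPropositional _≟_ using (_∈?_)

  adjacent? : ∀ x y → Dec (KK-Adj n m x y)
  adjacent? (i , j) (i' , j') = ¬? (i Fin.≟ i') ×-dec ¬? (j Fin.≟ j')

  vertices : List V
  vertices = cartesianProduct (allFin n) (allFin m)

  ∈-vertices : ∀ v → v ∈ vertices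
  ∈-vertices (i , j) = ∈-cartesianProduct⁺ (∈-allFin i) (∈-allFin j)

  vertices-unique : Unique vertices
  vertices-unique = Unique.cartesianProduct⁺ (Unique.allFin⁺ n) (Unique.allFin⁺ m)

  complement : List V → List V
  complement X = filter (∁? (_∈? X)) vertices

  length+length-complement≤ : ∀ {X} → Unique X → length X + length (complement X) ≤ length vertices
  length+length-complement≤ {X} u = begin
    length X + length (complement X)
      ≤⟨ +-monoˡ-≤ _ X≤X∩vertices ⟩
    length (filter (_∈? X) vertices) + length (complement X)
      ≡⟨ length-filter+length-filter-∁ (_∈? X) vertices ⟩
    length vertices ∎
    where
      open ≤-Reasoning
      X≤X∩vertices = Unique-⊆⇒length≤ u (λ {v} → ∈-filter⁺ (_∈? X) (∈-vertices v))

  length-vertices≤ : ∀ Y → length vertices ≤ length Y + length (complement Y)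
  length-vertices≤ Y = begin
    length vertices
      ≡⟨ sym (length-filter+length-filter-∁ (_∈? Y) vertices) ⟩
    length (filter (_∈? Y) vertices) + length (complement Y)
      ≤⟨ +-monoˡ-≤ _ Y∩vertices≤Y ⟩
    length Y + length (complement Y) ∎
    where
      open ≤-Reasoning
      Y∩vertices≤Y = Unique-⊆⇒length≤ (Unique.filter⁺ (_∈? Y) vertices-unique)
                                      (proj₂ ∘ ∈-filter⁻ (_∈? Y) {xs = vertices})

  nonadjacent⇒aligned : ∀ {x y : V} → ¬ KK-Adj n m x y → proj₁ x ≡ proj₁ y ⊎ proj₂ x ≡ proj₂ y
  nonadjacent⇒aligned {i , j} {i' , j'} ¬adj with i Fin.≟ i' | j Fin.≟ j'
  ... | yes i≡i' | _        = inj₁ i≡i'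
  ... | no _     | yes j≡j' = inj₂ j≡j'
  ... | no i≢i'  | no j≢j'  = contradiction (i≢i' , j≢j') ¬adj

  row-pair-distance : 1 < n → 2 < m → ∀ i {j j'} → j ≢ j' → IsDist (i , j) (i , j') 2
  row-pair-distance 1<n 2<m i {j} {j'} j≢j' with ∃-All≢-Fin (i ∷ []) 1<n | ∃-All≢-Fin (j ∷ j' ∷ []) 2<m
  ... | k , k≢i ∷ [] | l , l≢j ∷ l≢j' ∷ [] =
    isDist-two (j≢j' ∘ cong proj₂) (λ (i≢i , _) → i≢i refl) (≢-sym k≢i , ≢-sym l≢j) (k≢i , l≢j')

  column-pair-distance : 2 < n → 1 < m → ∀ {i i'} j → i ≢ i' → IsDist (i , j) (i' , j) 2
  column-pair-distance 2<n 1<m {i} {i'} j i≢i' with ∃-All≢-Fin (i ∷ i' ∷ []) 2<n | ∃-All≢-Fin (j ∷ []) 1<m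
  ... | k , k≢i ∷ k≢i' ∷ [] | l , l≢j ∷ [] =
    isDist-two (i≢i' ∘ cong proj₁) (λ (_ , j≢j) → j≢j refl) (≢-sym k≢i , ≢-sym l≢j) (k≢i' , l≢j)

  row-hiddenPair : 1 < n → 2 < m → ∀ {C} i {j j'} → j ≢ j' → (i , j) ∉ C → (i , j') ∉ C →
    (∀ {c} → c ∈ C → proj₁ c ≡ i ⊎ proj₂ c ∈ j ∷ j' ∷ []) → HiddenPair C
  row-hiddenPair 1<n 2<m i {j} {j'} j≢j' x∉C y∉C covered = record
    { x = i , j ; y = i , j' ; x∉C = x∉C ; y∉C = y∉C
    ; distance-two = row-pair-distance 1<n 2<m i j≢j'
    ; no-common-neighbour = λ (_ , j≢l) (k≢i , l≢j') c∈C →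
        [ k≢i , (λ { (here l≡j) → j≢l (sym l≡j) ; (there (here l≡j')) → l≢j' l≡j' }) ] (covered c∈C) }

  column-hiddenPair : 2 < n → 1 < m → ∀ {C} {i i'} j → i ≢ i' → (i , j) ∉ C → (i' , j) ∉ C →
    (∀ {c} → c ∈ C → proj₂ c ≡ j ⊎ proj₁ c ∈ i ∷ i' ∷ []) → HiddenPair C
  column-hiddenPair 2<n 1<m {i = i} {i'} j i≢i' x∉C y∉C covered = record
    { x = i , j ; y = i' , j ; x∉C = x∉C ; y∉C = y∉C
    ; distance-two = column-pair-distance 2<n 1<m j i≢i'
    ; no-common-neighbour = λ (i≢k , _) (k≢i' , l≢j) c∈C →
        [ l≢j , (λ { (here k≡i) → i≢k (sym k≡i) ; (there (here k≡i')) → k≢i' k≡i' }) ] (covered c∈C) }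

  two-columns-hiddenPair : 1 < n → 2 < m → ∀ {C u v} → length C < n → map proj₂ C ⊆ u ∷ v ∷ [] → HiddenPair C
  two-columns-hiddenPair 1<n 2<m {C} {u} {v} |C|<n columns⊆
    with ∃-All≢-Fin (map proj₁ C) (subst (_< n) (sym (length-map proj₁ C)) |C|<n) | distinct-pair-⊇ (<⇒≤ 2<m) u v
  ... | i , i≢rows | j , j' , j≢j' , uv⊆ =
    row-hiddenPair 1<n 2<m i j≢j' off-row off-row (λ c∈C → inj₂ (uv⊆ (columns⊆ (∈-map⁺ proj₂ c∈C))))
    where
      off-row : ∀ {l} → (i , l) ∉ C
      off-row p = All¬⇒¬Any i≢rows (∈-map⁺ proj₁ p)

  two-rows-hiddenPair : 2 < n → 1 < m → ∀ {C u v} → length C < m → map proj₁ C ⊆ u ∷ v ∷ [] → HiddenPair C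
  two-rows-hiddenPair 2<n 1<m {C} {u} {v} |C|<m rows⊆
    with ∃-All≢-Fin (map proj₂ C) (subst (_< m) (sym (length-map proj₂ C)) |C|<m) | distinct-pair-⊇ (<⇒≤ 2<n) u v
  ... | j , j≢columns | i , i' , i≢i' , uv⊆ =
    column-hiddenPair 2<n 1<m j i≢i' off-column off-column (λ c∈C → inj₂ (uv⊆ (rows⊆ (∈-map⁺ proj₁ c∈C))))
    where
      off-column : ∀ {k} → (k , j) ∉ C
      off-column p = All¬⇒¬Any j≢columns (∈-map⁺ proj₂ p)

  transversal-hiddenPair : 1 < n → 2 < m → ∀ {a b c : V} →
    proj₁ a ≢ proj₁ b → proj₁ a ≢ proj₁ c →
    proj₂ a ≢ proj₂ b → proj₂ a ≢ proj₂ c → proj₂ b ≢ proj₂ c →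
    HiddenPair (a ∷ b ∷ c ∷ [])
  transversal-hiddenPair 1<n 2<m {a₁ , _} a₁≢b₁ a₁≢c₁ a₂≢b₂ a₂≢c₂ b₂≢c₂ =
    row-hiddenPair 1<n 2<m a₁ b₂≢c₂
      (All¬⇒¬Any ((a₂≢b₂ ∘ sym ∘ cong proj₂) ∷ (a₁≢b₁ ∘ cong proj₁)
                  ∷ (b₂≢c₂ ∘ cong proj₂) ∷ []))
      (All¬⇒¬Any ((a₂≢c₂ ∘ sym ∘ cong proj₂) ∷ (a₁≢b₁ ∘ cong proj₁)
                  ∷ (a₁≢c₁ ∘ cong proj₁) ∷ []))
      λ where
        (here refl)                 → inj₁ refl
        (there (here refl))         → inj₂ (here refl)
        (there (there (here refl))) → inj₂ (there (here refl))

  module AtLeastFour (4≤n : 4 ≤ n) (4≤m : 4 ≤ m) where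
    private
      2<n : 2 < n
      2<n = <⇒≤ 4≤n
      1<n : 1 < n
      1<n = <⇒≤ 2<n
      2<m : 2 < m
      2<m = <⇒≤ 4≤m
      1<m : 1 < m
      1<m = <⇒≤ 2<m

    triple-hiddenPair : ∀ a b c → HiddenPair (a ∷ b ∷ c ∷ [])
    triple-hiddenPair a b c with distinct⊎twoValued Fin._≟_ (proj₂ a) (proj₂ b) (proj₂ c)
    ... | inj₂ (_ , _ , columns⊆) = two-columns-hiddenPair 1<n 2<m 4≤n columns⊆
    ... | inj₁ (a₂≢b₂ , a₂≢c₂ , b₂≢c₂) with distinct⊎twoValued Fin._≟_ (proj₁ a) (proj₁ b) (proj₁ c)
    ...   | inj₂ (_ , _ , rows⊆)     = two-rows-hiddenPair 2<n 1<m 4≤m rows⊆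
    ...   | inj₁ (a₁≢b₁ , a₁≢c₁ , _) =
      transversal-hiddenPair 1<n 2<m a₁≢b₁ a₁≢c₁ a₂≢b₂ a₂≢c₂ b₂≢c₂

    4≤length-complement : ∀ {X} → IsMutualVis X → 4 ≤ length (complement X)
    4≤length-complement {X} mv with length (complement X) ≤? 3
    ... | no ≰3  = ≰⇒> ≰3
    ... | yes ≤3 =
      let (a , b , c) , ⊆abc = ⊆-triple corner (complement X) ≤3
      in contradiction mv
           (hiddenPair⇒¬mutualVis _≟_ (λ {v} → ∈-filter⁺ (∁? (_∈? X)) (∈-vertices v))
             (HiddenPair-⊆ ⊆abc (triple-hiddenPair a b c)))
      where
        corner : V
        corner = fromℕ< (<⇒≤ 1<n) , fromℕ< (<⇒≤ 1<m)

    diagonal : Fin 4 → V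
    diagonal k = inject≤ k 4≤n , inject≤ k 4≤m

    X₀ : List V
    X₀ = complement (map diagonal (allFin 4))

    diagonal∉X₀ : ∀ k → diagonal k ∉ X₀
    diagonal∉X₀ k p = proj₂ (∈-filter⁻ (∁? (_∈? _)) {xs = vertices} p) (∈-map⁺ diagonal (∈-allFin k))

    diagonal-window : ∀ {x y} → proj₁ x ≡ proj₁ y ⊎ proj₂ x ≡ proj₂ y →
      ∃ λ z → KK-Adj n m x z × KK-Adj n m z y × z ∉ X₀
    diagonal-window {i , j} {_ , j'} (inj₁ refl) with ∃-All-toℕ≢ (toℕ i ∷ toℕ j ∷ toℕ j' ∷ []) ≤-refl
    ... | k , k≢i ∷ k≢j ∷ k≢j' ∷ [] =
      diagonal k , (toℕ≢⇒≢inject≤ 4≤n k≢i , toℕ≢⇒≢inject≤ 4≤m k≢j)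
                 , (≢-sym (toℕ≢⇒≢inject≤ 4≤n k≢i) , ≢-sym (toℕ≢⇒≢inject≤ 4≤m k≢j')) , diagonal∉X₀ k
    diagonal-window {i , j} {i' , _} (inj₂ refl) with ∃-All-toℕ≢ (toℕ j ∷ toℕ i ∷ toℕ i' ∷ []) ≤-refl
    ... | k , k≢j ∷ k≢i ∷ k≢i' ∷ [] =
      diagonal k , (toℕ≢⇒≢inject≤ 4≤n k≢i , toℕ≢⇒≢inject≤ 4≤m k≢j)
                 , (≢-sym (toℕ≢⇒≢inject≤ 4≤n k≢i') , ≢-sym (toℕ≢⇒≢inject≤ 4≤m k≢j)) , diagonal∉X₀ k

    X₀-unique : Unique X₀
    X₀-unique = Unique.filter⁺ _ vertices-unique

    X₀-totalMutualVis : IsTotalMutualVis X₀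
    X₀-totalMutualVis = totalMutualVis-if-windows _≟_ adjacent? (λ _ → diagonal-window ∘ nonadjacent⇒aligned)

    mutualVis⇒length≤ : ∀ X → Unique X → IsMutualVis X → length X ≤ length X₀
    mutualVis⇒length≤ X u mv = +-cancelʳ-≤ 4 (length X) (length X₀) (begin
      length X + 4                      ≤⟨ +-monoʳ-≤ (length X) (4≤length-complement mv) ⟩
      length X + length (complement X)  ≤⟨ length+length-complement≤ u ⟩
      length vertices                   ≤⟨ length-vertices≤ (map diagonal (allFin 4)) ⟩
      4 + length X₀                     ≡⟨ +-comm 4 (length X₀) ⟩
      length X₀ + 4                     ∎)
      where open ≤-Reasoning

corollary2p3 : (n m : ℕ) → 5 ≤ n → 5 ≤ m →
    Σ ℕ λ k → KK.IsMaxCard n m (KK.IsTotalMutualVis n m) k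
    × KK.IsMaxCard n m (KK.IsOuterMutualVis n m) k
    × KK.IsMaxCard n m (KK.IsDualMutualVis n m) k
    × KK.IsMaxCard n m (KK.IsMutualVis n m) k
corollary2p3 n m 5≤n 5≤m =
  length X₀ , maxCards-coincide X₀-unique X₀-totalMutualVis mutualVis⇒length≤
  where
    open DirectProduct n m
    open AtLeastFour (<⇒≤ 5≤n) (<⇒≤ 5≤m)
    open GraphProperties (KK-Adj n m)
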